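{- Let $N$ and $v$ be integers with $2\le v\le N+1$, let $f=\lfloor\frac{N+1}{v}\rfloor$ and $d=(f+1)v-N$. Let $\mathcal M$ be an admissible $v$-type for a set of size $N$. Then $|\mathcal M|\le\Lambda(N,v)$, where \[\Lambda(N,v)=\Big\lfloor\tfrac{1}{d}\sum_{i=f-d+2}^{f}(f+1-i)\tbinom{N}{i}\Big\rfloor+\sum_{i=0}^{f-d+1}\tbinom{N}{i}.\]
   Context: Binomial coefficients with negative lower index are $0$ and empty sums are $0$. A $v$-shape is a multiset of exactly $v$ nonnegative integers whose sum is at most $N$; for a shape $M$, $\mu_M(x)$ is the number of entries of $M$ equal to $x$. A $v$-type is a multiset $\mathcal M$ of $v$-shapes (counted with multiplicity in $|\mathcal M|$); it is admissible if $\sum_{M\in\mathcal M}\mu_M(x)\le\binom{N}{x}$ for all $0\le x\le N$. -}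

module Defs where

open import Data.Nat using (ℕ; zero; suc; _+_; _*_; _∸_; _≤_; _/_; _≤?_; NonZero)
open import Data.Nat.Combinatorics using (_C_)
open import Data.List using (List; length; map; upTo; filter)
open import Data.Nat.ListAction using (sum)
open import Data.List.Relation.Unary.All using (All)
open import Data.Product using (_×_)
open import Relation.Nullary.Decidable using (⌊_⌋)
open import Data.Nat using (_≟_)

-- Indices i below are always natural numbers; terms with a negative
-- lower index vanish by convention, so sums over integer ranges are
-- rewritten as sums over natural i with the range conditions.

Σ< : ℕ → (ℕ → ℕ) → ℕ
Σ< n f = sum (map f (upTo n))

μ : List ℕ → ℕ → ℕ
μ M x = length (filter (λ y → y ≟ x) M)

-- A v-shape (for ground set size N): a multiset of exactly v nonnegative
-- integers (represented as a list; order is irrelevant) with sum ≤ N.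
IsShape : ℕ → ℕ → List ℕ → Set
IsShape N v M = (length M ≡ v) × (sum M ≤ N)
  where open import Relation.Binary.PropositionalEquality using (_≡_)

-- A v-type is a multiset of v-shapes (a list, counted with multiplicity).
IsType : ℕ → ℕ → List (List ℕ) → Set
IsType N v 𝓜 = All (IsShape N v) 𝓜

Admissible : ℕ → List (List ℕ) → Set
Admissible N 𝓜 = (x : ℕ) → x ≤ N → sum (map (λ M → μ M x) 𝓜) ≤ N C x

-- Division with divisor written as suc (k ∸ 1): equals k whenever k ≥ 1,
-- which holds for both v and d under the hypothesis 2 ≤ v ≤ N+1
-- (v ≥ 2, and d = (f+1)v − N ≥ 1 since (f+1)v > N+1).
_div_ : ℕ → ℕ → ℕ
a div k = a / suc (k ∸ 1)

fOf : ℕ → ℕ → ℕ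
fOf N v = (N + 1) div v

dOf : ℕ → ℕ → ℕ
dOf N v = (fOf N v + 1) * v ∸ N

-- Σ over natural i ∈ [0, f] with i ≥ f−d+2 (integer bound), i.e. i + d ≥ f + 2,
-- of (f+1−i) * (N choose i)   (terms with negative i are 0 by convention)
S₁ : ℕ → ℕ → ℕ → ℕ
S₁ N f d = Σ< (suc f) (λ i → if ⌊ f + 2 ≤? i + d ⌋ then (f + 1 ∸ i) * (N C i) else 0)
  where open import Data.Bool using (if_then_else_)

-- Σ over natural i with 0 ≤ i ≤ f−d+1 (integer bound), i.e. i + d ≤ f + 1,
-- of (N choose i)  (empty if f−d+1 < 0)
S₂ : ℕ → ℕ → ℕ → ℕ
S₂ N f d = Σ< (suc f) (λ i → if ⌊ i + d ≤? f + 1 ⌋ then N C i else 0)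
  where open import Data.Bool using (if_then_else_)

Λ : ℕ → ℕ → ℕ
Λ N v = S₁ N (fOf N v) (dOf N v) div dOf N v + S₂ N (fOf N v) (dOf N v)

-- Give the value x the weight W x = min(d, f + 1 − x).  A v-shape M satisfies
-- Σ_{y∈M} (f + 1 − y) ≥ v(f + 1) − N = d, and min with d is subadditive, so every
-- shape has total weight at least d.  Summing over 𝓜 and counting each value x
-- through its multiplicity, admissibility gives
--   d |𝓜| ≤ Σ_{x ≤ f} W x · C(N, x) = Σ_{f−d+2 ≤ x ≤ f} (f + 1 − x) C(N, x) + d Σ_{x ≤ f−d+1} C(N, x),
-- and dividing by d yields |𝓜| ≤ Λ(N, v).
module Submission where

open import Defs
open import Data.Bool using (true; false; if_then_else_)
open import Data.List using (List; []; _∷_; length; map; applyUpTo)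
open import Data.List.Properties using (map-applyUpTo; map-cong)
open import Data.List.Relation.Unary.All using (All; []; _∷_)
import Data.List.Relation.Unary.All as All
open import Data.Nat using (ℕ; zero; suc; _+_; _≤_; _*_; _∸_; _<_; _⊓_; _/_; _%_; _≤?_; _≟_; z≤n; s≤s; s≤s⁻¹; NonZero)
open import Data.Nat.Combinatorics using (_C_)
open import Data.Nat.Divisibility using (n∣m*n)
open import Data.Nat.DivMod using (m≡m%n+[m/n]*n; m%n<n; m*n/n≡m; /-monoˡ-≤; +-distrib-/-∣ʳ; m/n<m)
open import Data.Nat.ListAction using (sum)
open import Data.Nat.Properties
open import Algebra.Properties.CommutativeSemigroup +-commutativeSemigroup using (interchange)
open import Data.Product using (_,_)
open import Data.Sum using (inj₁; inj₂)
open import Function using (_∘_)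
open import Relation.Binary.PropositionalEquality
open import Relation.Nullary using (contradiction)
open import Relation.Nullary.Decidable using (⌊_⌋; yes; no; does)

Σ<-suc : ∀ n (g : ℕ → ℕ) → Σ< (suc n) g ≡ g 0 + Σ< n (g ∘ suc)
Σ<-suc n g = cong (λ xs → g 0 + sum xs)
  (trans (map-applyUpTo suc g n) (sym (map-applyUpTo (λ x → x) (g ∘ suc) n)))

Σ<-cong : ∀ n {g h : ℕ → ℕ} → (∀ x → g x ≡ h x) → Σ< n g ≡ Σ< n h
Σ<-cong n g≗h = cong sum (map-cong g≗h (applyUpTo (λ x → x) n))

Σ<-mono-≤ : ∀ n {g h : ℕ → ℕ} → (∀ x → x < n → g x ≤ h x) → Σ< n g ≤ Σ< n h
Σ<-mono-≤ zero      g≤h = z≤n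
Σ<-mono-≤ (suc n) {g} {h} g≤h = begin
    Σ< (suc n) g           ≡⟨ Σ<-suc n g ⟩
    g 0 + Σ< n (g ∘ suc)   ≤⟨ +-mono-≤ (g≤h 0 (s≤s z≤n)) (Σ<-mono-≤ n (λ x x<n → g≤h (suc x) (s≤s x<n))) ⟩
    h 0 + Σ< n (h ∘ suc)   ≡⟨ Σ<-suc n h ⟨
    Σ< (suc n) h           ∎
  where open ≤-Reasoning

Σ<-+ : ∀ n (g h : ℕ → ℕ) → Σ< n (λ x → g x + h x) ≡ Σ< n g + Σ< n h
Σ<-+ zero    g h = refl
Σ<-+ (suc n) g h = begin
    Σ< (suc n) (λ x → g x + h x)                           ≡⟨ Σ<-suc n _ ⟩
    g 0 + h 0 + Σ< n (λ x → g (suc x) + h (suc x))         ≡⟨ cong (g 0 + h 0 +_) (Σ<-+ n (g ∘ suc) (h ∘ suc)) ⟩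
    g 0 + h 0 + (Σ< n (g ∘ suc) + Σ< n (h ∘ suc))          ≡⟨ interchange (g 0) (h 0) _ _ ⟩
    (g 0 + Σ< n (g ∘ suc)) + (h 0 + Σ< n (h ∘ suc))        ≡⟨ cong₂ _+_ (Σ<-suc n g) (Σ<-suc n h) ⟨
    Σ< (suc n) g + Σ< (suc n) h                            ∎
  where open ≡-Reasoning

Σ<-*ʳ : ∀ n c (g : ℕ → ℕ) → Σ< n (λ x → g x * c) ≡ Σ< n g * c
Σ<-*ʳ zero    c g = refl
Σ<-*ʳ (suc n) c g = begin
    Σ< (suc n) (λ x → g x * c)           ≡⟨ Σ<-suc n _ ⟩
    g 0 * c + Σ< n (λ x → g (suc x) * c) ≡⟨ cong (g 0 * c +_) (Σ<-*ʳ n c (g ∘ suc)) ⟩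
    g 0 * c + Σ< n (g ∘ suc) * c         ≡⟨ *-distribʳ-+ c (g 0) _ ⟨
    (g 0 + Σ< n (g ∘ suc)) * c           ≡⟨ cong (_* c) (Σ<-suc n g) ⟨
    Σ< (suc n) g * c                     ∎
  where open ≡-Reasoning

Σ<-*0 : ∀ n (g : ℕ → ℕ) → Σ< n (λ x → g x * 0) ≡ 0
Σ<-*0 n g = trans (Σ<-*ʳ n 0 g) (*-zeroʳ (Σ< n g))

δ : ℕ → ℕ → ℕ
δ y x = if does (y ≟ x) then 1 else 0

μ≡sum-δ : ∀ M x → μ M x ≡ sum (map (λ y → δ y x) M)
μ≡sum-δ []      x = refl
μ≡sum-δ (y ∷ M) x with does (y ≟ x)
... | true  = cong suc (μ≡sum-δ M x)
... | false = μ≡sum-δ M x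

Σ<-δ : ∀ n y (g : ℕ → ℕ) → (∀ x → n ≤ x → g x ≡ 0) → Σ< n (λ x → g x * δ y x) ≡ g y
Σ<-δ zero    y       g g≥n≡0 = sym (g≥n≡0 y z≤n)
Σ<-δ (suc n) zero    g g≥n≡0 = begin
    Σ< (suc n) (λ x → g x * δ 0 x)    ≡⟨ Σ<-suc n _ ⟩
    g 0 * 1 + Σ< n (λ x → g (suc x) * 0) ≡⟨ cong₂ _+_ (*-identityʳ (g 0)) (Σ<-*0 n (g ∘ suc)) ⟩
    g 0 + 0                           ≡⟨ +-identityʳ (g 0) ⟩
    g 0                               ∎
  where open ≡-Reasoning
Σ<-δ (suc n) (suc y) g g≥n≡0 = begin
    Σ< (suc n) (λ x → g x * δ (suc y) x)     ≡⟨ Σ<-suc n _ ⟩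
    g 0 * 0 + Σ< n (λ x → g (suc x) * δ y x) ≡⟨ cong (_+ Σ< n (λ x → g (suc x) * δ y x)) (*-zeroʳ (g 0)) ⟩
    Σ< n (λ x → g (suc x) * δ y x)           ≡⟨ Σ<-δ n y (g ∘ suc) (λ x n≤x → g≥n≡0 (suc x) (s≤s n≤x)) ⟩
    g (suc y)                                ∎
  where open ≡-Reasoning

sum-map-Σ<-* : ∀ {A : Set} n (g : ℕ → ℕ) (F : A → ℕ → ℕ) ys →
               sum (map (λ y → Σ< n (λ x → g x * F y x)) ys) ≡ Σ< n (λ x → g x * sum (map (λ y → F y x) ys))
sum-map-Σ<-* n g F []       = sym (Σ<-*0 n g)
sum-map-Σ<-* n g F (y ∷ ys) = begin
    Σ< n (λ x → g x * F y x) + sum (map (λ y → Σ< n (λ x → g x * F y x)) ys)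
      ≡⟨ cong (Σ< n (λ x → g x * F y x) +_) (sum-map-Σ<-* n g F ys) ⟩
    Σ< n (λ x → g x * F y x) + Σ< n (λ x → g x * sum (map (λ y → F y x) ys))
      ≡⟨ Σ<-+ n _ _ ⟨
    Σ< n (λ x → g x * F y x + g x * sum (map (λ y → F y x) ys))
      ≡⟨ Σ<-cong n (λ x → *-distribˡ-+ (g x) (F y x) _) ⟨
    Σ< n (λ x → g x * sum (map (λ y → F y x) (y ∷ ys))) ∎
  where open ≡-Reasoning

sum-map≡Σ<-μ : ∀ n (g : ℕ → ℕ) → (∀ x → n ≤ x → g x ≡ 0) →
               ∀ M → sum (map g M) ≡ Σ< n (λ x → g x * μ M x)
sum-map≡Σ<-μ n g g≥n≡0 M = begin
    sum (map g M)                                        ≡⟨ cong sum (map-cong (λ y → Σ<-δ n y g g≥n≡0) M) ⟨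
    sum (map (λ y → Σ< n (λ x → g x * δ y x)) M)         ≡⟨ sum-map-Σ<-* n g δ M ⟩
    Σ< n (λ x → g x * sum (map (λ y → δ y x) M))         ≡⟨ Σ<-cong n (λ x → cong (g x *_) (μ≡sum-δ M x)) ⟨
    Σ< n (λ x → g x * μ M x)                             ∎
  where open ≡-Reasoning

totalμ : List (List ℕ) → ℕ → ℕ
totalμ 𝓜 x = sum (map (λ M → μ M x) 𝓜)

sum-map-sum-map≡Σ<-totalμ : ∀ n (g : ℕ → ℕ) → (∀ x → n ≤ x → g x ≡ 0) →
                            ∀ 𝓜 → sum (map (sum ∘ map g) 𝓜) ≡ Σ< n (λ x → g x * totalμ 𝓜 x)
sum-map-sum-map≡Σ<-totalμ n g g≥n≡0 𝓜 =
  trans (cong sum (map-cong (sum-map≡Σ<-μ n g g≥n≡0) 𝓜)) (sum-map-Σ<-* n g μ 𝓜)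

length*≤sum-map : ∀ {A : Set} d (s : A → ℕ) {ys} → All (λ y → d ≤ s y) ys → length ys * d ≤ sum (map s ys)
length*≤sum-map d s []                = z≤n
length*≤sum-map d s (d≤sy ∷ d≤sys) = +-mono-≤ d≤sy (length*≤sum-map d s d≤sys)

weighted-size-bound : ∀ N n (W : ℕ → ℕ) d (𝓜 : List (List ℕ)) →
  n ≤ suc N → (∀ x → n ≤ x → W x ≡ 0) →
  All (λ M → d ≤ sum (map W M)) 𝓜 → Admissible N 𝓜 →
  length 𝓜 * d ≤ Σ< n (λ x → W x * (N C x))
weighted-size-bound N n W d 𝓜 n≤1+N W≥n≡0 heavy adm = begin
    length 𝓜 * d                         ≤⟨ length*≤sum-map d (sum ∘ map W) heavy ⟩
    sum (map (sum ∘ map W) 𝓜)            ≡⟨ sum-map-sum-map≡Σ<-totalμ n W W≥n≡0 𝓜 ⟩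
    Σ< n (λ x → W x * totalμ 𝓜 x)        ≤⟨ Σ<-mono-≤ n (λ x x<n → *-monoʳ-≤ (W x) (adm x (s≤s⁻¹ (≤-trans x<n n≤1+N)))) ⟩
    Σ< n (λ x → W x * (N C x))           ∎
  where open ≤-Reasoning

length*≤sum+sum-map-∸ : ∀ c (M : List ℕ) → length M * c ≤ sum M + sum (map (c ∸_) M)
length*≤sum+sum-map-∸ c []      = z≤n
length*≤sum+sum-map-∸ c (y ∷ M) = begin
    c + length M * c                                      ≤⟨ +-mono-≤ (m≤n+m∸n c y) (length*≤sum+sum-map-∸ c M) ⟩
    (y + (c ∸ y)) + (sum M + sum (map (c ∸_) M))          ≡⟨ interchange y (c ∸ y) _ _ ⟩
    (y + sum M) + ((c ∸ y) + sum (map (c ∸_) M))          ∎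
  where open ≤-Reasoning

m⊓[n+o]≤m⊓n+m⊓o : ∀ m n o → m ⊓ (n + o) ≤ m ⊓ n + m ⊓ o
m⊓[n+o]≤m⊓n+m⊓o m n o with ≤-total m n | ≤-total m o
... | inj₁ m≤n | _ = begin
    m ⊓ (n + o)     ≤⟨ m⊓n≤m m (n + o) ⟩
    m               ≡⟨ m≤n⇒m⊓n≡m m≤n ⟨
    m ⊓ n           ≤⟨ m≤m+n (m ⊓ n) (m ⊓ o) ⟩
    m ⊓ n + m ⊓ o   ∎
  where open ≤-Reasoning
... | inj₂ _ | inj₁ m≤o = begin
    m ⊓ (n + o)     ≤⟨ m⊓n≤m m (n + o) ⟩
    m               ≡⟨ m≤n⇒m⊓n≡m m≤o ⟨
    m ⊓ o           ≤⟨ m≤n+m (m ⊓ o) (m ⊓ n) ⟩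
    m ⊓ n + m ⊓ o   ∎
  where open ≤-Reasoning
... | inj₂ n≤m | inj₂ o≤m = begin
    m ⊓ (n + o)     ≤⟨ m⊓n≤n m (n + o) ⟩
    n + o           ≡⟨ cong₂ _+_ (m≥n⇒m⊓n≡n n≤m) (m≥n⇒m⊓n≡n o≤m) ⟨
    m ⊓ n + m ⊓ o   ∎
  where open ≤-Reasoning

m⊓sum≤sum-map-m⊓ : ∀ m (g : ℕ → ℕ) M → m ⊓ sum (map g M) ≤ sum (map (λ y → m ⊓ g y) M)
m⊓sum≤sum-map-m⊓ m g []      = ≤-reflexive (⊓-zeroʳ m)
m⊓sum≤sum-map-m⊓ m g (y ∷ M) =
  ≤-trans (m⊓[n+o]≤m⊓n+m⊓o m (g y) _) (+-monoʳ-≤ (m ⊓ g y) (m⊓sum≤sum-map-m⊓ m g M))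

shape-weight : ∀ N v c d {M} → d + N ≡ v * c → IsShape N v M → d ≤ sum (map (λ y → d ⊓ (c ∸ y)) M)
shape-weight N v c d {M} d+N≡v*c (length≡v , sum≤N) =
  ≤-trans (⊓-glb ≤-refl d≤deficit) (m⊓sum≤sum-map-m⊓ d (c ∸_) M)
  where
  deficit : ℕ
  deficit = sum (map (c ∸_) M)
  d≤deficit : d ≤ deficit
  d≤deficit = +-cancelʳ-≤ N d deficit (begin
      d + N                ≡⟨ d+N≡v*c ⟩
      v * c                ≡⟨ cong (_* c) length≡v ⟨
      length M * c         ≤⟨ length*≤sum+sum-map-∸ c M ⟩
      sum M + deficit      ≤⟨ +-monoˡ-≤ deficit sum≤N ⟩
      N + deficit          ≡⟨ +-comm N deficit ⟩
      deficit + N          ∎)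
    where open ≤-Reasoning

weight-split : ∀ N f d x →
  (d ⊓ (f + 1 ∸ x)) * (N C x) ≡
  (if ⌊ f + 2 ≤? x + d ⌋ then (f + 1 ∸ x) * (N C x) else 0) + (if ⌊ x + d ≤? f + 1 ⌋ then N C x else 0) * d
weight-split N f d x with x + d ≤? f + 1 | f + 2 ≤? x + d
... | yes x+d≤f+1 | yes f+2≤x+d = contradiction (≤-trans (≤-trans (≤-reflexive (sym (+-suc f 1))) f+2≤x+d) x+d≤f+1) 1+n≰n
... | yes x+d≤f+1 | no _ =
  trans (cong (_* (N C x)) (m≤n⇒m⊓n≡m (m+n≤o⇒m≤o∸n d (≤-trans (≤-reflexive (+-comm d x)) x+d≤f+1))))
        (*-comm d (N C x))
... | no _ | yes f+2≤x+d =
  trans (cong (_* (N C x)) (m≥n⇒m⊓n≡n (m≤n+o⇒m∸n≤o (f + 1) x (≤-trans (+-monoʳ-≤ f (n≤1+n 1)) f+2≤x+d))))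
        (sym (+-identityʳ _))
... | no x+d≰f+1 | no f+2≰x+d = contradiction (≤-trans (≤-reflexive (+-suc f 1)) (≰⇒> x+d≰f+1)) f+2≰x+d

Σ<-weight≡S₁+S₂*d : ∀ N f d → Σ< (suc f) (λ x → (d ⊓ (f + 1 ∸ x)) * (N C x)) ≡ S₁ N f d + S₂ N f d * d
Σ<-weight≡S₁+S₂*d N f d = begin
    Σ< (suc f) (λ x → (d ⊓ (f + 1 ∸ x)) * (N C x))  ≡⟨ Σ<-cong (suc f) (weight-split N f d) ⟩
    Σ< (suc f) (λ x → s₁ x + s₂ x * d)               ≡⟨ Σ<-+ (suc f) s₁ (λ x → s₂ x * d) ⟩
    S₁ N f d + Σ< (suc f) (λ x → s₂ x * d)           ≡⟨ cong (S₁ N f d +_) (Σ<-*ʳ (suc f) d s₂) ⟩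
    S₁ N f d + S₂ N f d * d                          ∎
  where
  open ≡-Reasoning
  s₁ s₂ : ℕ → ℕ
  s₁ x = if ⌊ f + 2 ≤? x + d ⌋ then (f + 1 ∸ x) * (N C x) else 0
  s₂ x = if ⌊ x + d ≤? f + 1 ⌋ then N C x else 0

≤div+ : ∀ {d} L A B → 0 < d → L * d ≤ A + B * d → L ≤ A div d + B
≤div+ {d@(suc _)} L A B _ L*d≤A+B*d = begin
    L                    ≡⟨ m*n/n≡m L d ⟨
    L * d / d            ≤⟨ /-monoˡ-≤ d L*d≤A+B*d ⟩
    (A + B * d) / d      ≡⟨ +-distrib-/-∣ʳ A (n∣m*n B) ⟩
    A / d + B * d / d    ≡⟨ cong (A / d +_) (m*n/n≡m B d) ⟩
    A / d + B            ∎
  where open ≤-Reasoning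

m<[1+m/n]*n : ∀ m n .{{_ : NonZero n}} → m < suc (m / n) * n
m<[1+m/n]*n m n = begin-strict
    m                  ≡⟨ m≡m%n+[m/n]*n m n ⟩
    m % n + m / n * n  <⟨ +-monoˡ-< (m / n * n) (m%n<n m n) ⟩
    n + m / n * n      ∎
  where open ≤-Reasoning

lemma3p1 : (N v : ℕ) → 2 ≤ v → v ≤ N + 1 →
           (𝓜 : List (List ℕ)) → IsType N v 𝓜 → Admissible N 𝓜 →
           length 𝓜 ≤ Λ N v
lemma3p1 N v@(suc (suc _)) (s≤s (s≤s _)) _ 𝓜 type adm = ≤div+ (length 𝓜) (S₁ N f d) (S₂ N f d) 0<d (begin
    length 𝓜 * d                               ≤⟨ weighted-size-bound N (suc f) W d 𝓜 1+f≤1+N W≥1+f≡0 heavy adm ⟩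
    Σ< (suc f) (λ x → W x * (N C x))           ≡⟨ Σ<-weight≡S₁+S₂*d N f d ⟩
    S₁ N f d + S₂ N f d * d                    ∎)
  where
  open ≤-Reasoning
  f d : ℕ
  f = fOf N v
  d = dOf N v
  W : ℕ → ℕ
  W x = d ⊓ (f + 1 ∸ x)
  N<[f+1]*v : N < (f + 1) * v
  N<[f+1]*v = <-trans (m<m+n N (s≤s z≤n))
    (subst (λ k → N + 1 < k * v) (+-comm 1 f) (m<[1+m/n]*n (N + 1) v))
  0<d : 0 < d
  0<d = m<n⇒0<n∸m N<[f+1]*v
  1+f≤1+N : suc f ≤ suc N
  1+f≤1+N = subst (λ m → m / v < suc N) (+-comm 1 N) (m/n<m (suc N) v (s≤s (s≤s z≤n)))
  W≥1+f≡0 : ∀ x → suc f ≤ x → W x ≡ 0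
  W≥1+f≡0 x 1+f≤x = trans (cong (d ⊓_) (m≤n⇒m∸n≡0 (subst (_≤ x) (+-comm 1 f) 1+f≤x))) (⊓-zeroʳ d)
  d+N≡v*[f+1] : d + N ≡ v * (f + 1)
  d+N≡v*[f+1] = trans (m∸n+n≡m (<⇒≤ N<[f+1]*v)) (*-comm (f + 1) v)
  heavy : All (λ M → d ≤ sum (map W M)) 𝓜
  heavy = All.map (λ {M} → shape-weight N v (f + 1) d {M} d+N≡v*[f+1]) type
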